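{- Let $\varphi$ be a $\mathbb{BST}$-conjunction, $\psi$ a conjunction of atoms of the form $x=\{y\}$, $x=\{y\}$ a conjunct of $\psi$, and $M$ a set assignment satisfying $\varphi\wedge\Xi^\psi_\varphi$ such that $My\notin Mv$ for every $v\in\mathrm{Vars}(\varphi\wedge\psi)$. Define $M_{x,y}$ by $M_{x,y}v = Mv$ if $Mx\cap Mv=\emptyset$, $M_{x,y}v=(Mv\setminus Mx)\cup\{My\}$ otherwise, for $v\in\mathrm{Vars}(\varphi\wedge\psi)$, and $M_{x,y}\tilde v = M\tilde v$ for the auxiliary variables. Then for all $u,v\in\mathrm{Vars}(\varphi\wedge\psi)$: $Mu\subseteq Mv$ if and only if $M_{x,y}u\subseteq M_{x,y}v$.
   Context: Set variables range over the von Neumann universe of well-founded sets. A $\mathbb{BST}$-conjunction is a conjunction of literals of the forms $u=v\setminus w$ and $u\neq v\setminus w$. $\mathrm{Vars}(\varphi\wedge\psi)$ is the set of variables occurring in $\varphi\wedge\psi$; for each $v$ in it a new distinct auxiliary variable $\tilde v$ is introduced. $\Xi^\psi_\varphi$ is the conjunction of: (i) $x\not\subseteq y$ for each conjunct $x=\{y\}$ of $\psi$; (ii) $(y=y'\leftrightarrow x=x')$ for each pair of conjuncts $x=\{y\}$, $x'=\{y'\}$ of $\psi$; (iii) $(x\cap v\neq\emptyset\to x\subseteq v)$ for each conjunct $x=\{y\}$ of $\psi$ and each $v\in\mathrm{Vars}(\varphi\wedge\psi)$; (iv) $(x\cap v\neq\emptyset\to\tilde y\subsetneq\tilde v)$ for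 each conjunct $x=\{y\}$ of $\psi$ and $v\in\mathrm{Vars}(\varphi\wedge\psi)$; (v) $(x=y\to\tilde x=\tilde y)$ for all $x,y\in\mathrm{Vars}(\varphi\wedge\psi)$. In the definition of $M_{x,y}$ the union $(Mv\setminus Mx)\cup\{My\}$ is disjoint. -}

module Defs where

open import Data.Nat using (ℕ)
open import Data.Empty using (⊥; ⊥-elim)
open import Data.Unit using (⊤; tt)
open import Data.Sum using (_⊎_; inj₁; inj₂)
open import Data.Product using (Σ; Σ-syntax; _×_; _,_; proj₁)
open import Data.List using (List; []; _∷_; _++_; concatMap)
open import Data.List.Membership.Propositional using (_∈_)
open import Data.List.Relation.Unary.All using (All)
open import Relation.Nullary using (¬_; Dec; yes; no)
open import Axiom.ExcludedMiddle using (ExcludedMiddle)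
open import Level using (0ℓ)

-- Well-founded sets: Aczel's iterative sets (an inductive, hence
-- well-founded, cumulative hierarchy), with extensional equality.

data V : Set₁ where
  sup : (A : Set) → (A → V) → V

_≐_ : V → V → Set
sup A f ≐ sup B g =
  ((a : A) → Σ[ b ∈ B ] (f a ≐ g b)) × ((b : B) → Σ[ a ∈ A ] (f a ≐ g b))

_∈ˢ_ : V → V → Set
x ∈ˢ sup A f = Σ[ a ∈ A ] (x ≐ f a)

_∉ˢ_ : V → V → Set
x ∉ˢ y = ¬ (x ∈ˢ y)

_⊆ˢ_ : V → V → Set
sup A f ⊆ˢ Y = (a : A) → f a ∈ˢ Y

_⊊ˢ_ : V → V → Set
X ⊊ˢ Y = (X ⊆ˢ Y) × ¬ (X ≐ Y)

∅ˢ : V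
∅ˢ = sup ⊥ ⊥-elim

｛_｝ : V → V
｛ a ｝ = sup ⊤ (λ _ → a)

_∪ˢ_ : V → V → V
sup A f ∪ˢ sup B g = sup (A ⊎ B) h
  where
  h : A ⊎ B → V
  h (inj₁ a) = f a
  h (inj₂ b) = g b

_∩ˢ_ : V → V → V
sup A f ∩ˢ Y = sup (Σ[ a ∈ A ] (f a ∈ˢ Y)) (λ p → f (proj₁ p))

_∖ˢ_ : V → V → V
sup A f ∖ˢ Y = sup (Σ[ a ∈ A ] (f a ∉ˢ Y)) (λ p → f (proj₁ p))

-- Syntax.  Original variables are natural numbers; the variable
-- assignment domain also contains, for every original variable v, a
-- distinct auxiliary variable ṽ = aux v.

data Var : Set where
  var : ℕ → Var
  aux : ℕ → Var

-- BST literals: u = v ∖ w  and  u ≠ v ∖ w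
data Lit : Set where
  eqDiff  : ℕ → ℕ → ℕ → Lit
  neqDiff : ℕ → ℕ → ℕ → Lit

BSTConj : Set
BSTConj = List Lit

-- a conjunction of atoms x = {y}; the pair (x , y) encodes x = {y}
SingConj : Set
SingConj = List (ℕ × ℕ)

litVars : Lit → List ℕ
litVars (eqDiff u v w)  = u ∷ v ∷ w ∷ []
litVars (neqDiff u v w) = u ∷ v ∷ w ∷ []

Vars : BSTConj → SingConj → List ℕ
Vars φ ψ = concatMap litVars φ ++ concatMap (λ p → Data.Product.proj₁ p ∷ Data.Product.proj₂ p ∷ []) ψ

Assignment : Set₁
Assignment = Var → V

SatLit : Assignment → Lit → Set
SatLit M (eqDiff u v w)  = M (var u) ≐ (M (var v) ∖ˢ M (var w))
SatLit M (neqDiff u v w) = ¬ (M (var u) ≐ (M (var v) ∖ˢ M (var w)))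

SatBST : Assignment → BSTConj → Set
SatBST M φ = All (SatLit M) φ

SatΞ : Assignment → BSTConj → SingConj → Set
SatΞ M φ ψ =
  -- (i)
  (∀ x y → (x , y) ∈ ψ → ¬ (M (var x) ⊆ˢ M (var y)))
  × (∀ x y x′ y′ → (x , y) ∈ ψ → (x′ , y′) ∈ ψ →
       ((M (var y) ≐ M (var y′) → M (var x) ≐ M (var x′))
        × (M (var x) ≐ M (var x′) → M (var y) ≐ M (var y′))))
  -- (iii)
  × (∀ x y v → (x , y) ∈ ψ → v ∈ Vars φ ψ →
       ¬ ((M (var x) ∩ˢ M (var v)) ≐ ∅ˢ) → M (var x) ⊆ˢ M (var v))
  × (∀ x y v → (x , y) ∈ ψ → v ∈ Vars φ ψ →
       ¬ ((M (var x) ∩ˢ M (var v)) ≐ ∅ˢ) → M (aux y) ⊊ˢ M (aux v))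
  × (∀ x y → x ∈ Vars φ ψ → y ∈ Vars φ ψ →
       M (var x) ≐ M (var y) → M (aux x) ≐ M (aux y))

-- M_{x,y}; the case distinction "Mx ∩ Mv = ∅ or not" is decided by
-- classical excluded middle (the paper's metatheory is classical ZF).
Mxy : ExcludedMiddle 0ℓ → Assignment → ℕ → ℕ → Assignment
Mxy lem M x y (var v) with lem {(M (var x) ∩ˢ M (var v)) ≐ ∅ˢ}
... | yes _ = M (var v)
... | no  _ = (M (var v) ∖ˢ M (var x)) ∪ˢ ｛ M (var y) ｝
Mxy lem M x y (aux v) = M (aux v)

module Submission where

open import Defs
open import Data.Nat using (ℕ)
open import Data.Product using (_,_; _×_; proj₁; proj₂)
open import Data.Sum using (_⊎_; inj₁; inj₂)
open import Data.Empty using (⊥-elim)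
open import Data.Unit using (tt)
open import Data.List.Membership.Propositional using (_∈_)
open import Function.Bundles using (_⇔_; mk⇔)
open import Relation.Nullary using (¬_; yes; no)
open import Axiom.ExcludedMiddle using (ExcludedMiddle)
open import Level using (0ℓ)

-- Idea: by Ξ (iii), Mx lies inside every Mv it meets, so M_{x,y} replaces
-- this whole block by the single point My, which lies in no Mv.  If neither
-- Mu nor Mv meets Mx nothing changes.  If both do, the block is removed from
-- both sides and the same point added to both.  If only Mv meets Mx, Mu is
-- disjoint from the block and does not contain My, so neither side of Mv
-- matters.  If only Mu meets Mx, both inclusions fail: Mx ⊆ Mu ⊆ Mv would
-- force the nonempty (Ξ (i)) Mx to be disjoint from itself, and My ∉ Mv.

≐-refl : ∀ a → a ≐ a
≐-refl (sup A f) = (λ i → i , ≐-refl (f i)) , (λ i → i , ≐-refl (f i))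

≐-sym : ∀ {a b} → a ≐ b → b ≐ a
≐-sym {sup A f} {sup B g} (p , q) =
  (λ j → proj₁ (q j) , ≐-sym (proj₂ (q j))) , (λ i → proj₁ (p i) , ≐-sym (proj₂ (p i)))

≐-trans : ∀ {a b c} → a ≐ b → b ≐ c → a ≐ c
≐-trans {sup A f} {sup B g} {sup C h} (p₁ , q₁) (p₂ , q₂) =
  (λ i → let j = proj₁ (p₁ i) in proj₁ (p₂ j) , ≐-trans (proj₂ (p₁ i)) (proj₂ (p₂ j))) ,
  (λ k → let j = proj₁ (q₂ k) in proj₁ (q₁ j) , ≐-trans (proj₂ (q₁ j)) (proj₂ (q₂ k)))

∈-resp-≐ : ∀ {a b Y} → a ≐ b → a ∈ˢ Y → b ∈ˢ Y
∈-resp-≐ {Y = sup C h} a≐b (c , a≐hc) = c , ≐-trans (≐-sym a≐b) a≐hc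

∈-⊆-trans : ∀ {a U W} → a ∈ˢ U → U ⊆ˢ W → a ∈ˢ W
∈-⊆-trans {U = sup A f} (i , a≐fi) U⊆W = ∈-resp-≐ (≐-sym a≐fi) (U⊆W i)

∈⇒⊆ : ∀ {U W} → (∀ a → a ∈ˢ U → a ∈ˢ W) → U ⊆ˢ W
∈⇒⊆ {sup A f} h i = h (f i) (i , ≐-refl (f i))

∈-∖⁺ : ∀ {a U Y} → a ∈ˢ U → a ∉ˢ Y → a ∈ˢ (U ∖ˢ Y)
∈-∖⁺ {U = sup A f} (i , a≐fi) a∉Y = (i , λ fi∈Y → a∉Y (∈-resp-≐ (≐-sym a≐fi) fi∈Y)) , a≐fi

∈-∖⁻ : ∀ {a U Y} → a ∈ˢ (U ∖ˢ Y) → (a ∈ˢ U) × (a ∉ˢ Y)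
∈-∖⁻ {U = sup A f} ((i , fi∉Y) , a≐fi) = (i , a≐fi) , λ a∈Y → fi∉Y (∈-resp-≐ a≐fi a∈Y)

∈-∪⁺ˡ : ∀ {a U W} → a ∈ˢ U → a ∈ˢ (U ∪ˢ W)
∈-∪⁺ˡ {U = sup A f} {sup B g} (i , e) = inj₁ i , e

∈-∪⁺ʳ : ∀ {a U W} → a ∈ˢ W → a ∈ˢ (U ∪ˢ W)
∈-∪⁺ʳ {U = sup A f} {sup B g} (j , e) = inj₂ j , e

∈-∪⁻ : ∀ {a U W} → a ∈ˢ (U ∪ˢ W) → (a ∈ˢ U) ⊎ (a ∈ˢ W)
∈-∪⁻ {U = sup A f} {sup B g} (inj₁ i , e) = inj₁ (i , e)
∈-∪⁻ {U = sup A f} {sup B g} (inj₂ j , e) = inj₂ (j , e)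

∩≐∅⇒∉ : ∀ {a X W} → (X ∩ˢ W) ≐ ∅ˢ → a ∈ˢ X → a ∉ˢ W
∩≐∅⇒∉ {X = sup A f} (p , _) (i , a≐fi) a∈W = proj₁ (p (i , ∈-resp-≐ a≐fi a∈W))

collapse : V → V → V → V
collapse X Y U = (U ∖ˢ X) ∪ˢ ｛ Y ｝

∈-collapse⁺ : ∀ {a X Y U} → a ∈ˢ U → a ∉ˢ X → a ∈ˢ collapse X Y U
∈-collapse⁺ a∈U a∉X = ∈-∪⁺ˡ (∈-∖⁺ a∈U a∉X)

∈-collapse⁻ : ∀ {a X Y U W} → Y ∉ˢ U → a ∈ˢ U → a ∈ˢ collapse X Y W → a ∈ˢ W
∈-collapse⁻ Y∉U a∈U a∈cW with ∈-∪⁻ a∈cW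
... | inj₁ a∈W∖X     = proj₁ (∈-∖⁻ a∈W∖X)
... | inj₂ (_ , a≐Y) = ⊥-elim (Y∉U (∈-resp-≐ a≐Y a∈U))

Y∈collapse : ∀ X Y U → Y ∈ˢ collapse X Y U
Y∈collapse X Y U = ∈-∪⁺ʳ {U = U ∖ˢ X} (tt , ≐-refl Y)

⊆-collapseʳ⇔ : ∀ {X Y U W} → Y ∉ˢ U → (X ∩ˢ U) ≐ ∅ˢ →
  (U ⊆ˢ W) ⇔ (U ⊆ˢ collapse X Y W)
⊆-collapseʳ⇔ Y∉U X∩U≐∅ = mk⇔
  (λ U⊆W → ∈⇒⊆ λ a a∈U → ∈-collapse⁺ (∈-⊆-trans a∈U U⊆W) (λ a∈X → ∩≐∅⇒∉ X∩U≐∅ a∈X a∈U))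
  (λ U⊆cW → ∈⇒⊆ λ a a∈U → ∈-collapse⁻ Y∉U a∈U (∈-⊆-trans a∈U U⊆cW))

⊆-collapseˡ⇔ : ∀ {X Y U W} → X ⊆ˢ U → (X ∩ˢ W) ≐ ∅ˢ → ¬ (X ⊆ˢ Y) → Y ∉ˢ W →
  (U ⊆ˢ W) ⇔ (collapse X Y U ⊆ˢ W)
⊆-collapseˡ⇔ {X} {Y} {U} X⊆U X∩W≐∅ X⊈Y Y∉W = mk⇔
  (λ U⊆W → ⊥-elim (X⊈Y (∈⇒⊆ λ a a∈X →
    ⊥-elim (∩≐∅⇒∉ X∩W≐∅ a∈X (∈-⊆-trans (∈-⊆-trans a∈X X⊆U) U⊆W)))))
  (λ cU⊆W → ⊥-elim (Y∉W (∈-⊆-trans (Y∈collapse X Y U) cU⊆W)))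

⊆-collapse⇔ : ExcludedMiddle 0ℓ → ∀ {X Y U W} → X ⊆ˢ W → Y ∉ˢ U →
  (U ⊆ˢ W) ⇔ (collapse X Y U ⊆ˢ collapse X Y W)
⊆-collapse⇔ lem {X} {Y} {U} {W} X⊆W Y∉U = mk⇔ to from
  where
  to : U ⊆ˢ W → collapse X Y U ⊆ˢ collapse X Y W
  to U⊆W = ∈⇒⊆ λ _ → ∈cU⇒∈cW
    where
    ∈cU⇒∈cW : ∀ {a} → a ∈ˢ collapse X Y U → a ∈ˢ collapse X Y W
    ∈cU⇒∈cW a∈cU with ∈-∪⁻ a∈cU
    ... | inj₁ a∈U∖X = let (a∈U , a∉X) = ∈-∖⁻ a∈U∖X in ∈-collapse⁺ (∈-⊆-trans a∈U U⊆W) a∉X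
    ... | inj₂ a∈｛Y｝ = ∈-∪⁺ʳ {U = W ∖ˢ X} a∈｛Y｝

  from : collapse X Y U ⊆ˢ collapse X Y W → U ⊆ˢ W
  from cU⊆cW = ∈⇒⊆ λ _ → ∈U⇒∈W
    where
    ∈U⇒∈W : ∀ {a} → a ∈ˢ U → a ∈ˢ W
    ∈U⇒∈W {a} a∈U with lem {a ∈ˢ X}
    ... | yes a∈X = ∈-⊆-trans a∈X X⊆W
    ... | no  a∉X = ∈-collapse⁻ Y∉U a∈U (∈-⊆-trans (∈-collapse⁺ a∈U a∉X) cU⊆cW)

lemma6 : (lem : ExcludedMiddle 0ℓ) (φ : BSTConj) (ψ : SingConj) (x y : ℕ) →
    (x , y) ∈ ψ → (M : Assignment) →
    SatBST M φ → SatΞ M φ ψ →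
    (∀ v → v ∈ Vars φ ψ → M (var y) ∉ˢ M (var v)) →
    ∀ u v → u ∈ Vars φ ψ → v ∈ Vars φ ψ →
    (M (var u) ⊆ˢ M (var v)) ⇔ (Mxy lem M x y (var u) ⊆ˢ Mxy lem M x y (var v))
lemma6 lem φ ψ x y xy∈ψ M _ (x⊈y , _ , meets⇒⊆ , _) y∉ u v u∈ v∈
  with lem {(M (var x) ∩ˢ M (var u)) ≐ ∅ˢ} | lem {(M (var x) ∩ˢ M (var v)) ≐ ∅ˢ}
... | yes _     | yes _     = mk⇔ (λ s → s) (λ s → s)
... | yes x∩u≐∅ | no  _     = ⊆-collapseʳ⇔ (y∉ u u∈) x∩u≐∅
... | no  x∩u≢∅ | yes x∩v≐∅ =
  ⊆-collapseˡ⇔ (meets⇒⊆ x y u xy∈ψ u∈ x∩u≢∅) x∩v≐∅ (x⊈y x y xy∈ψ) (y∉ v v∈)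
... | no  _     | no  x∩v≢∅ = ⊆-collapse⇔ lem (meets⇒⊆ x y v xy∈ψ v∈ x∩v≢∅) (y∉ u u∈)
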